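{- Let $L$ be a finite lattice with minimum $\hat{0}$ and maximum $\hat{1}$, generalized graded by $\rho$. If $x \in L$ is a left-modular element, then $$\chi(L,t) = \sum_{b \in H(L):\ b \wedge x = \hat{0}} \mu(b)\, t^{\rho(\hat{1}) - \rho(b \vee x)}\, \chi([b, b \vee x], t).$$
   Context: A generalized rank function on $L$ is a function $\rho : \{(u,v) \in L \times L : u \le v\} \to \mathbb{R}$ such that $\rho(a,c) = \rho(a,b) + \rho(b,c)$ for all $a \le b \le c$; then $L$ is said to be generalized graded by $\rho$, and one writes $\rho(u) = \rho(\hat{0}, u)$. The (generalized) characteristic polynomial is $\chi(L,t) = \sum_{u \in L} \mu(u)\, t^{\rho(u,\hat{1})}$, where $\mu$ is the Möbius function of $L$ and $\mu(u) = \mu(\hat{0},u)$; for an interval $[a,b]$, $\chi([a,b],t) = \sum_{u \in [a,b]} \mu(a,u)\, t^{\rho(u,b)}$ using the restriction of $\rho$. The support of $\mu$ is $H(L) = \{u \in L : \mu(\hat{0},u) \neq 0\}$. An element $x$ is left-modular if for all $y, z \in L$ with $z < y$ one has $z \vee (x \wedge y) = (z \vee x) \wedge y$. -}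

module Defs where

open import Level using (Level; _⊔_) renaming (suc to lsuc)
open import Data.Bool using (Bool; true; false; not; if_then_else_) renaming (_∧_ to _∧ᵇ_)
open import Data.Nat using (ℕ; zero; suc)
open import Data.Integer as ℤ using (ℤ; +_; -[1+_])
open import Data.List using (List; []; _∷_; length)
open import Data.List.Membership.Propositional using (_∈_)
open import Data.List.Relation.Unary.Unique.Propositional using (Unique)
open import Data.Product using (_×_)
open import Relation.Nullary using (¬_; yes; no; Dec; does)
open import Relation.Binary.Core using (Rel)
open import Relation.Binary.Definitions using (Decidable; DecidableEquality; Minimum; Maximum)
open import Relation.Binary.PropositionalEquality using (_≡_)
open import Relation.Binary.Lattice.Structures using (IsLattice)
open import Algebra.Bundles using (CommutativeRing; AbelianGroup)
open import Algebra.Core using (Op₂)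

-- A finite lattice presented with propositional equality on its carrier,
-- a finite duplicate-free complete enumeration of its elements, and
-- decidable equality / order (automatic classically for finite lattices).
record FiniteLattice (c ℓ : Level) : Set (lsuc (c ⊔ ℓ)) where
  field
    Carrier   : Set c
    _≤_       : Rel Carrier ℓ
    _∨_       : Op₂ Carrier
    _∧_       : Op₂ Carrier
    ⊥ ⊤       : Carrier
    isLattice : IsLattice _≡_ _≤_ _∨_ _∧_
    minimum   : Minimum _≤_ ⊥
    maximum   : Maximum _≤_ ⊤
    _≟_       : DecidableEquality Carrier
    _≤?_      : Decidable _≤_
    elems     : List Carrier
    complete  : ∀ u → u ∈ elems
    unique    : Unique elems

  _<_ : Rel Carrier (c ⊔ ℓ)
  u < v = u ≤ v × ¬ (u ≡ v)

module _ {c ℓ} (L : FiniteLattice c ℓ) where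
  open FiniteLattice L

  LeftModular : Carrier → Set (c ⊔ ℓ)
  LeftModular x = ∀ y z → z < y → (z ∨ (x ∧ y)) ≡ ((z ∨ x) ∧ y)

  -- generalized rank function with values in an abelian group G
  -- (the paper uses G = (ℝ,+)); defined on all pairs, only the
  -- values on comparable pairs u ≤ v matter.
  IsGenRank : ∀ {g ℓg} (G : AbelianGroup g ℓg) → (Carrier → Carrier → AbelianGroup.Carrier G) → Set (c ⊔ ℓ ⊔ ℓg)
  IsGenRank G ρ = ∀ a b d → a ≤ b → b ≤ d → ρ a d ≈ (ρ a b ∙ ρ b d)
    where open AbelianGroup G

  sumℤ : List Carrier → (Carrier → Bool) → (Carrier → ℤ) → ℤ
  sumℤ [] p f = + 0
  sumℤ (u ∷ us) p f with p u
  ... | true = f u ℤ.+ sumℤ us p f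
  ... | false = sumℤ us p f

  -- Möbius function, by the usual recursion
  --   μ(a,a) = 1,  μ(a,b) = - Σ_{a ≤ c < b} μ(a,c) for a < b,  μ(a,b) = 0 otherwise,
  -- run with fuel (fuel = number of elements suffices, chains have < n steps).
  inHalfOpen : Carrier → Carrier → Carrier → Bool
  inHalfOpen a b u = does (a ≤? u) ∧ᵇ (does (u ≤? b) ∧ᵇ not (does (u ≟ b)))

  μ-fuel : ℕ → Carrier → Carrier → ℤ
  μ-fuel zero a b = + 0
  μ-fuel (suc k) a b with a ≟ b
  ... | yes _ = + 1
  ... | no _ with a ≤? b
  ...   | no _ = + 0
  ...   | yes _ = ℤ.- sumℤ elems (inHalfOpen a b) (μ-fuel k a)

  μ : Carrier → Carrier → ℤ
  μ = μ-fuel (length elems)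

  module _ {r ℓr} (R : CommutativeRing r ℓr) where
    open CommutativeRing R renaming (Carrier to R∣; _+_ to _+ᴿ_; _*_ to _*ᴿ_)

    ιℕ : ℕ → R∣
    ιℕ zero    = 0#
    ιℕ (suc n) = 1# +ᴿ ιℕ n

    ι : ℤ → R∣
    ι (+ n)      = ιℕ n
    ι (-[1+ n ]) = - (ιℕ (suc n))

    sumR : (Carrier → Bool) → (Carrier → R∣) → R∣
    sumR p f = go elems
      where
      go : List Carrier → R∣
      go [] = 0#
      go (u ∷ us) = if p u then f u +ᴿ go us else go us

    inClosed : Carrier → Carrier → Carrier → Bool
    inClosed a b u = does (a ≤? u) ∧ᵇ does (u ≤? b)

    -- χ([a,b],t) = Σ_{u ∈ [a,b]} μ(a,u) t^{ρ(u,b)},  evaluated at the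
    -- formal variable via  tpow : G → R  (tpow r plays the role of t^r).
    χ-int : ∀ {g} {G : Set g} → (Carrier → Carrier → G) → (G → R∣) → Carrier → Carrier → R∣
    χ-int ρ tpow a b = sumR (inClosed a b) (λ u → ι (μ a u) *ᴿ tpow (ρ u b))

    χ : ∀ {g} {G : Set g} → (Carrier → Carrier → G) → (G → R∣) → R∣
    χ ρ tpow = χ-int ρ tpow ⊥ ⊤

    rhs23 : ∀ {g ℓg} (G : AbelianGroup g ℓg) → (Carrier → Carrier → AbelianGroup.Carrier G) →
            (AbelianGroup.Carrier G → R∣) → Carrier → R∣
    rhs23 G ρ tpow x = sumR sel (λ b → (ι (μ ⊥ b) *ᴿ tpow (ρ ⊥ ⊤ ∙ ρ ⊥ (b ∨ x) ⁻¹)) *ᴿ χ-int ρ tpow b (b ∨ x))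
      where
      open AbelianGroup G using (_∙_; _⁻¹)
      sel : Carrier → Bool
      sel b = not (does (μ ⊥ b ℤ.≟ + 0)) ∧ᵇ does ((b ∧ x) ≟ ⊥)

-- tpow : G → R is a "power of t": a monoid map from (G,+,0) to (R,·,1)
record IsPowerMap {g ℓg r ℓr} (G : AbelianGroup g ℓg) (R : CommutativeRing r ℓr)
                  (tpow : AbelianGroup.Carrier G → CommutativeRing.Carrier R) : Set (g ⊔ ℓg ⊔ ℓr) where
  field
    cong  : ∀ {p q} → AbelianGroup._≈_ G p q → CommutativeRing._≈_ R (tpow p) (tpow q)
    zero≡ : CommutativeRing._≈_ R (tpow (AbelianGroup.ε G)) (CommutativeRing.1# R)
    hom   : ∀ p q → CommutativeRing._≈_ R (tpow (AbelianGroup._∙_ G p q))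
                                           (CommutativeRing._*_ R (tpow p) (tpow q))

{-# OPTIONS --safe #-}
module Submission where

-- Put F(u) = Σ μ(0̂,b) μ(b,u) over the b with b ∧ x = 0̂ and b ≤ u ≤ b ∨ x.  Summing F over
-- [0̂,v] and using Σ_{u ∈ [b,w]} μ(b,u) = δ(b,w) leaves the sum of μ(0̂,b) over the b with
-- b ∧ x = 0̂ and b = v ∧ (b ∨ x).  By left-modularity these are exactly the b ≤ v when
-- x ∧ v = 0̂, and there are none otherwise, so the sum is δ(0̂,v) and F = μ(0̂,-) by Möbius
-- inversion.  Substituting F in χ(L,t) = Σ_u μ(u) t^ρ(u,1̂) and splitting
-- t^ρ(u,1̂) = t^(ρ(1̂) − ρ(b ∨ x)) t^ρ(u,b ∨ x) regroups χ(L,t) into the right-hand side;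
-- restricting b to H(L) only drops terms with μ(b) = 0.

open import Defs
open import Level using (Level)
open import Algebra.Bundles using (CommutativeRing; AbelianGroup)

open import Data.Bool using (Bool; true; false; not; if_then_else_) renaming (_∧_ to _∧ᵇ_)
import Data.Bool.Properties as Boolₚ
open import Data.Nat as ℕ using (ℕ; zero; suc; s≤s; z≤n)
import Data.Nat.Properties as ℕₚ
open import Data.Integer as ℤ using (ℤ; +_; -[1+_])
import Data.Integer.Properties as ℤₚ
open import Data.List using (List; []; _∷_; length; lookup)
open import Data.List.Membership.Propositional using (_∈_)
open import Data.List.Relation.Unary.Any using (here; there)
open import Data.List.Relation.Unary.All as All using (All; []; _∷_)
open import Data.List.Relation.Unary.AllPairs.Core using ([]; _∷_)
open import Data.List.Relation.Unary.Unique.Propositional using (Unique)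
open import Data.Product using (_×_; _,_; proj₁; proj₂; ∃)
open import Data.Empty using (⊥-elim)
open import Function.Base using (_∘_)
open import Function.Bundles using (_⇔_; mk⇔)
open import Relation.Nullary using (¬_; yes; no; Dec; does; ¬?; _×-dec_)
open import Relation.Nullary.Decidable using (dec-true; dec-false; does-⇔)
open import Relation.Binary.PropositionalEquality as ≡ using (_≡_; _≢_)
open import Relation.Binary.Lattice.Bundles using (Lattice)
open import Relation.Binary.Lattice.Structures using (IsLattice)
import Relation.Binary.Lattice.Properties.Lattice as LatticeProperties
import Relation.Binary.Lattice.Properties.MeetSemilattice as MeetSemilatticeProperties
import Relation.Binary.Reasoning.Setoid as SetoidReasoning
import Algebra.Properties.AbelianGroup as AbelianGroupProperties
import Algebra.Properties.CommutativeSemigroup as CommutativeSemigroupProperties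
import Algebra.Properties.Ring as RingProperties
import Algebra.Properties.Semiring.Sum as SemiringSum

does⁻ : ∀ {p} {P : Set p} (P? : Dec P) → does P? ≡ true → P
does⁻ (yes p) _ = p

module _ {a} {A : Set a} where

  countᵇ : (A → Bool) → List A → ℕ
  countᵇ p []       = 0
  countᵇ p (u ∷ us) = if p u then suc (countᵇ p us) else countᵇ p us

  countᵇ-true : ∀ us → countᵇ (λ _ → true) us ≡ length us
  countᵇ-true []       = ≡.refl
  countᵇ-true (u ∷ us) = ≡.cong suc (countᵇ-true us)

  module _ {p q : A → Bool} (p⇒q : ∀ w → p w ≡ true → q w ≡ true) where

    countᵇ-mono-≤ : ∀ us → countᵇ p us ℕ.≤ countᵇ q us
    countᵇ-mono-≤ []       = z≤n
    countᵇ-mono-≤ (u ∷ us) with p u | q u | p⇒q u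
    ... | true  | true  | _  = s≤s (countᵇ-mono-≤ us)
    ... | true  | false | pq with () ← pq ≡.refl
    ... | false | true  | _  = ℕₚ.m≤n⇒m≤1+n (countᵇ-mono-≤ us)
    ... | false | false | _  = countᵇ-mono-≤ us

    countᵇ-mono-< : ∀ {y us} → y ∈ us → p y ≡ false → q y ≡ true → countᵇ p us ℕ.< countᵇ q us
    countᵇ-mono-< {us = u ∷ us} (here ≡.refl) py qy rewrite py | qy = s≤s (countᵇ-mono-≤ us)
    countᵇ-mono-< {us = u ∷ us} (there y∈us) py qy with p u | q u | p⇒q u
    ... | true  | true  | _  = s≤s (countᵇ-mono-< y∈us py qy)
    ... | true  | false | pq with () ← pq ≡.refl
    ... | false | true  | _  = ℕₚ.m≤n⇒m≤1+n (countᵇ-mono-< y∈us py qy)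
    ... | false | false | _  = countᵇ-mono-< y∈us py qy

  countᵇ-< : ∀ {p : A → Bool} {y us} → y ∈ us → p y ≡ false → countᵇ p us ℕ.< length us
  countᵇ-< {p} {us = us} y∈us py =
    ≡.subst (countᵇ p us ℕ.<_) (countᵇ-true us) (countᵇ-mono-< (λ _ _ → ≡.refl) y∈us py ≡.refl)

module _ {g ℓg} (G : AbelianGroup g ℓg) where
  open AbelianGroup G
  open AbelianGroupProperties G using (⁻¹-∙-comm; xyx⁻¹≈y)
  open SetoidReasoning setoid

  xy∙[xz]⁻¹∙z≈y : ∀ x y z → ((x ∙ y) ∙ (x ∙ z) ⁻¹) ∙ z ≈ y
  xy∙[xz]⁻¹∙z≈y x y z = begin
    ((x ∙ y) ∙ (x ∙ z) ⁻¹) ∙ z       ≈⟨ assoc (x ∙ y) ((x ∙ z) ⁻¹) z ⟩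
    (x ∙ y) ∙ ((x ∙ z) ⁻¹ ∙ z)       ≈⟨ ∙-congˡ (∙-congʳ (⁻¹-∙-comm x z)) ⟨
    (x ∙ y) ∙ ((x ⁻¹ ∙ z ⁻¹) ∙ z)    ≈⟨ ∙-congˡ (assoc (x ⁻¹) (z ⁻¹) z) ⟩
    (x ∙ y) ∙ (x ⁻¹ ∙ (z ⁻¹ ∙ z))    ≈⟨ ∙-congˡ (∙-congˡ (inverseˡ z)) ⟩
    (x ∙ y) ∙ (x ⁻¹ ∙ ε)             ≈⟨ ∙-congˡ (identityʳ (x ⁻¹)) ⟩
    (x ∙ y) ∙ x ⁻¹                   ≈⟨ xyx⁻¹≈y x y ⟩
    y                                ∎

module MöbiusFunction {c ℓ} (L : FiniteLattice c ℓ) where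
  open FiniteLattice L
  open IsLattice isLattice using (x≤x∨y; y≤x∨y; ∨-least; x∧y≤x; x∧y≤y; ∧-greatest)
    renaming (antisym to ≤-antisym; reflexive to ≤-reflexive; trans to ≤-trans)

  private
    lattice : Lattice c c ℓ
    lattice = record
      { Carrier = Carrier ; _≈_ = _≡_ ; _≤_ = _≤_ ; _∨_ = _∨_ ; _∧_ = _∧_ ; isLattice = isLattice }

  open LatticeProperties lattice using (∧-absorbs-∨)
  open MeetSemilatticeProperties (Lattice.meetSemilattice lattice) using (∧-comm)

  ≤-refl : ∀ {a} → a ≤ a
  ≤-refl = ≤-reflexive ≡.refl

  ≤⊥⇒≡⊥ : ∀ {a} → a ≤ ⊥ → a ≡ ⊥
  ≤⊥⇒≡⊥ {a} a≤⊥ = ≤-antisym a≤⊥ (minimum a)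

  ∨-identityʳ : ∀ a → a ∨ ⊥ ≡ a
  ∨-identityʳ a = ≤-antisym (∨-least ≤-refl (minimum a)) (x≤x∨y a ⊥)

  ∧-interval : ∀ {b u v w} → (u ≤ v × (b ≤ u × u ≤ w)) ⇔ (b ≤ u × u ≤ (v ∧ w))
  ∧-interval {b} {u} {v} {w} = mk⇔
    (λ (u≤v , b≤u , u≤w) → b≤u , ∧-greatest u≤v u≤w)
    (λ (b≤u , u≤v∧w) → ≤-trans u≤v∧w (x∧y≤x v w) , b≤u , ≤-trans u≤v∧w (x∧y≤y v w))

  -- For b ≤ v, left-modularity turns b ∨ (x ∧ v) into (b ∨ x) ∧ v, and x ∧ v = 0̂
  -- makes the left-hand side b.
  left-modular-complement : ∀ {x b v} → LeftModular L x →
                            (b ∧ x ≡ ⊥ × b ≡ v ∧ (b ∨ x)) ⇔ (b ≤ v × x ∧ v ≡ ⊥)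
  left-modular-complement {x} {b} {v} x-lm = mk⇔ to from
    where
    to : b ∧ x ≡ ⊥ × b ≡ v ∧ (b ∨ x) → b ≤ v × x ∧ v ≡ ⊥
    to (b∧x≡⊥ , b≡v∧[b∨x]) =
      b≤v , ≤⊥⇒≡⊥ (≡.subst ((x ∧ v) ≤_) b∧x≡⊥ (∧-greatest x∧v≤b (x∧y≤x x v)))
      where
      b≤v : b ≤ v
      b≤v = ≡.subst (_≤ v) (≡.sym b≡v∧[b∨x]) (x∧y≤x v (b ∨ x))
      x∧v≤b : (x ∧ v) ≤ b
      x∧v≤b = ≡.subst ((x ∧ v) ≤_) (≡.sym b≡v∧[b∨x])
                (∧-greatest (x∧y≤y x v) (≤-trans (x∧y≤x x v) (y≤x∨y b x)))

    from : b ≤ v × x ∧ v ≡ ⊥ → b ∧ x ≡ ⊥ × b ≡ v ∧ (b ∨ x)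
    from (b≤v , x∧v≡⊥) = b∧x≡⊥ , b≡v∧[b∨x] (b ≟ v)
      where
      b∧x≡⊥ : b ∧ x ≡ ⊥
      b∧x≡⊥ = ≤⊥⇒≡⊥ (≡.subst ((b ∧ x) ≤_) x∧v≡⊥
                (∧-greatest (x∧y≤y b x) (≤-trans (x∧y≤x b x) b≤v)))
      b≡v∧[b∨x] : Dec (b ≡ v) → b ≡ v ∧ (b ∨ x)
      b≡v∧[b∨x] (yes ≡.refl) = ≡.sym (∧-absorbs-∨ b x)
      b≡v∧[b∨x] (no b≢v) = begin
        b                ≡⟨ ∨-identityʳ b ⟨
        b ∨ ⊥            ≡⟨ ≡.cong (b ∨_) x∧v≡⊥ ⟨
        b ∨ (x ∧ v)      ≡⟨ x-lm v b (b≤v , b≢v) ⟩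
        (b ∨ x) ∧ v      ≡⟨ ∧-comm (b ∨ x) v ⟩
        v ∧ (b ∨ x)      ∎
        where open ≡.≡-Reasoning

  disjoint : Carrier → Carrier → Bool
  disjoint x b = does ((b ∧ x) ≟ ⊥)

  _∈[_,_⟩ : Carrier → Carrier → Carrier → Bool
  u ∈[ a , b ⟩ = inHalfOpen L a b u

  HalfOpen : Carrier → Carrier → Carrier → Set _
  HalfOpen a b u = a ≤ u × u ≤ b × u ≢ b

  -- u ∈[ a , b ⟩ is definitionally does (halfOpen? a b u).
  halfOpen? : ∀ a b u → Dec (HalfOpen a b u)
  halfOpen? a b u = a ≤? u ×-dec (u ≤? b ×-dec ¬? (u ≟ b))

  ∉[_,_⟩ : ∀ a b → b ∈[ a , b ⟩ ≡ false
  ∉[ a , b ⟩ = dec-false (halfOpen? a b b) (λ (_ , _ , b≢b) → b≢b ≡.refl)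

  width : Carrier → Carrier → ℕ
  width a b = countᵇ (_∈[ a , b ⟩) elems

  width-< : ∀ {a b u} → u ∈[ a , b ⟩ ≡ true → width a u ℕ.< width a b
  width-< {a} {b} {u} u∈[a,b⟩ = countᵇ-mono-< [a,u⟩⊆[a,b⟩ (complete u) ∉[ a , u ⟩ u∈[a,b⟩
    where
    [a,u⟩⊆[a,b⟩ : ∀ w → w ∈[ a , u ⟩ ≡ true → w ∈[ a , b ⟩ ≡ true
    [a,u⟩⊆[a,b⟩ w w∈[a,u⟩ with does⁻ (halfOpen? a u w) w∈[a,u⟩ | does⁻ (halfOpen? a b u) u∈[a,b⟩
    ... | a≤w , w≤u , _ | _ , u≤b , u≢b =
      dec-true (halfOpen? a b w) (a≤w , ≤-trans w≤u u≤b , λ { ≡.refl → u≢b (≤-antisym u≤b w≤u) })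

  width-<-length : ∀ a b → width a b ℕ.< length elems
  width-<-length a b = countᵇ-< (complete b) ∉[ a , b ⟩

  sumℤ-cong : ∀ {p} {f g : Carrier → ℤ} us → (∀ u → p u ≡ true → f u ≡ g u) →
              sumℤ L us p f ≡ sumℤ L us p g
  sumℤ-cong []            _   = ≡.refl
  sumℤ-cong {p} (u ∷ us) f≗g with p u in pu
  ... | true  = ≡.cong₂ ℤ._+_ (f≗g u pu) (sumℤ-cong us f≗g)
  ... | false = sumℤ-cong us f≗g

  μ-fuel-irrelevant : ∀ k k′ a b → width a b ℕ.< k → width a b ℕ.< k′ →
                      μ-fuel L k a b ≡ μ-fuel L k′ a b
  μ-fuel-irrelevant (suc k) (suc k′) a b w<k w<k′ with a ≟ b
  ... | yes _ = ≡.refl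
  ... | no _ with a ≤? b
  ...   | no _  = ≡.refl
  ...   | yes _ = ≡.cong ℤ.-_ (sumℤ-cong elems λ u u∈[a,b⟩ →
                    μ-fuel-irrelevant k k′ a u (shrink u∈[a,b⟩ w<k) (shrink u∈[a,b⟩ w<k′))
    where
    shrink : ∀ {u n} → u ∈[ a , b ⟩ ≡ true → width a b ℕ.< suc n → width a u ℕ.< n
    shrink u∈[a,b⟩ w<1+n = ℕₚ.<-≤-trans (width-< u∈[a,b⟩) (ℕₚ.≤-pred w<1+n)

  μ-fuel≡μ : ∀ {k a b} → width a b ℕ.< k → μ-fuel L k a b ≡ μ L a b
  μ-fuel≡μ {k} {a} {b} w<k = μ-fuel-irrelevant k (length elems) a b w<k (width-<-length a b)

  μ-refl : ∀ a → μ L a a ≡ + 1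
  μ-refl a = ≡.trans (≡.sym (μ-fuel≡μ (ℕₚ.n<1+n (width a a)))) unfold
    where
    unfold : μ-fuel L (suc (width a a)) a a ≡ + 1
    unfold with a ≟ a
    ... | yes _   = ≡.refl
    ... | no a≢a = ⊥-elim (a≢a ≡.refl)

  μ-step : ∀ {a b} → a ≤ b → a ≢ b → μ L a b ≡ ℤ.- sumℤ L elems (_∈[ a , b ⟩) (μ L a)
  μ-step {a} {b} a≤b a≢b = begin
    μ L a b                                        ≡⟨ μ-fuel≡μ (ℕₚ.n<1+n n) ⟨
    μ-fuel L (suc n) a b                           ≡⟨ unfold ⟩
    ℤ.- sumℤ L elems (_∈[ a , b ⟩) (μ-fuel L n a)  ≡⟨ ≡.cong ℤ.-_ (sumℤ-cong elems λ _ → μ-fuel≡μ ∘ width-<) ⟩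
    ℤ.- sumℤ L elems (_∈[ a , b ⟩) (μ L a)         ∎
    where
    open ≡.≡-Reasoning
    n = width a b
    unfold : μ-fuel L (suc n) a b ≡ ℤ.- sumℤ L elems (_∈[ a , b ⟩) (μ-fuel L n a)
    unfold with a ≟ b
    ... | yes a≡b = ⊥-elim (a≢b a≡b)
    ... | no _ with a ≤? b
    ...   | yes _  = ≡.refl
    ...   | no a≰b = ⊥-elim (a≰b a≤b)

  module InRing {r ℓr} (R : CommutativeRing r ℓr) where
    open CommutativeRing R renaming (Carrier to A) hiding (zero)
    open RingProperties ring using (-0#≈0#; -‿+-comm; -‿involutive; +-cancelʳ)
    open CommutativeSemigroupProperties +-commutativeSemigroup using ()
      renaming (interchange to +-interchange)
    open CommutativeSemigroupProperties *-commutativeSemigroup using ()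
      renaming (x∙yz≈y∙xz to x*yz≈y*xz)
    open SemiringSum semiring
      using (sum; sum-cong-≋; sum-replicate-zero; ∑-distrib-+; ∑-comm; *-distribˡ-sum; *-distribʳ-sum)
    open SetoidReasoning setoid

    _∈[_,_] : Carrier → Carrier → Carrier → Bool
    u ∈[ a , b ] = inClosed L R a b u

    when : Bool → A → A
    when b y = if b then y else 0#

    when-∧ : ∀ b b′ y → when (b ∧ᵇ b′) y ≡ when b (when b′ y)
    when-∧ true  _ _ = ≡.refl
    when-∧ false _ _ = ≡.refl

    when-comm : ∀ b b′ y → when b (when b′ y) ≡ when b′ (when b y)
    when-comm true  _     _ = ≡.refl
    when-comm false true  _ = ≡.refl
    when-comm false false _ = ≡.refl

    when-cong : ∀ b {y z} → y ≈ z → when b y ≈ when b z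
    when-cong true  y≈z = y≈z
    when-cong false _   = refl

    when-zero : ∀ b {y} → y ≈ 0# → when b y ≈ 0#
    when-zero true  y≈0 = y≈0
    when-zero false _   = refl

    when-*ˡ : ∀ b x y → when b (x * y) ≈ x * when b y
    when-*ˡ true  _ _ = refl
    when-*ˡ false x _ = sym (zeroʳ x)

    when-*ʳ : ∀ b x y → when b x * y ≈ when b (x * y)
    when-*ʳ true  _ _ = refl
    when-*ʳ false _ y = zeroˡ y

    δ : Carrier → Carrier → A
    δ a b = when (does (a ≟ b)) 1#

    Σ⟨_⟩ : List Carrier → (Carrier → A) → A
    Σ⟨ us ⟩ f = sum (λ i → f (lookup us i))

    Σ : (Carrier → A) → A
    Σ = Σ⟨ elems ⟩

    Σ[_,_] : Carrier → Carrier → (Carrier → A) → A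
    Σ[ a , b ] f = Σ (λ u → when (u ∈[ a , b ]) (f u))

    Σ[_,_⟩ : Carrier → Carrier → (Carrier → A) → A
    Σ[ a , b ⟩ f = Σ (λ u → when (u ∈[ a , b ⟩) (f u))

    Σ-cong : ∀ {f g} → (∀ u → f u ≈ g u) → Σ f ≈ Σ g
    Σ-cong f≈g = sum-cong-≋ (f≈g ∘ lookup elems)

    Σ-zero : ∀ {f} → (∀ u → f u ≈ 0#) → Σ f ≈ 0#
    Σ-zero f≈0 = trans (Σ-cong f≈0) (sum-replicate-zero (length elems))

    Σ-distrib-+ : ∀ f g → Σ (λ u → f u + g u) ≈ Σ f + Σ g
    Σ-distrib-+ f g = ∑-distrib-+ (f ∘ lookup elems) (g ∘ lookup elems)

    Σ-comm : ∀ (h : Carrier → Carrier → A) → Σ (λ u → Σ (h u)) ≈ Σ (λ v → Σ (λ u → h u v))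
    Σ-comm h = ∑-comm (λ i j → h (lookup elems i) (lookup elems j))

    *-distribˡ-Σ : ∀ x f → x * Σ f ≈ Σ (λ u → x * f u)
    *-distribˡ-Σ x f = *-distribˡ-sum x (f ∘ lookup elems)

    *-distribʳ-Σ : ∀ x f → Σ f * x ≈ Σ (λ u → f u * x)
    *-distribʳ-Σ x f = *-distribʳ-sum x (f ∘ lookup elems)

    Σ-when : ∀ b f → Σ (λ u → when b (f u)) ≈ when b (Σ f)
    Σ-when true  _ = refl
    Σ-when false _ = Σ-zero (λ _ → refl)

    Σ-when-*ˡ : ∀ b x f → Σ (λ u → when b (x * f u)) ≈ when b (x * Σ f)
    Σ-when-*ˡ b x f = trans (Σ-when b (λ u → x * f u)) (when-cong b (sym (*-distribˡ-Σ x f)))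

    Σ⟨⟩-δ-∉ : ∀ {a} {f : Carrier → A} {us} → All (a ≢_) us →
              Σ⟨ us ⟩ (λ u → when (does (u ≟ a)) (f u)) ≈ 0#
    Σ⟨⟩-δ-∉ [] = refl
    Σ⟨⟩-δ-∉ {a} {f} {u ∷ _} (a≢u ∷ a∉us) rewrite dec-false (u ≟ a) (a≢u ∘ ≡.sym) =
      trans (+-identityˡ _) (Σ⟨⟩-δ-∉ {f = f} a∉us)

    Σ⟨⟩-δ : ∀ {a} {f : Carrier → A} {us} → Unique us → a ∈ us →
            Σ⟨ us ⟩ (λ u → when (does (u ≟ a)) (f u)) ≈ f a
    Σ⟨⟩-δ {a} {f} (a∉us ∷ _) (here ≡.refl) rewrite dec-true (a ≟ a) ≡.refl =
      trans (+-congˡ (Σ⟨⟩-δ-∉ {f = f} a∉us)) (+-identityʳ _)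
    Σ⟨⟩-δ {a} {f} {u ∷ _} (u∉us ∷ us-unique) (there a∈us)
      rewrite dec-false (u ≟ a) (All.lookup u∉us a∈us) =
      trans (+-identityˡ _) (Σ⟨⟩-δ {f = f} us-unique a∈us)

    Σ-δ : ∀ a f → Σ (λ u → when (does (u ≟ a)) (f u)) ≈ f a
    Σ-δ a f = Σ⟨⟩-δ {f = f} unique (complete a)

    private
      -- sumR folds a function local to its where-block over elems.  Abstracting
      -- elems exposes that function, and it solves the metavariable in this type.
      sumR-unfold : ∀ p f →
        (λ go → ∃ λ (fold : List Carrier → A) → fold ≡ go × sumR L R p f ≡ go elems) _
      sumR-unfold p f with elems
      ... | _ = _ , ≡.refl , ≡.refl

      sumR-fold : (Carrier → Bool) → (Carrier → A) → List Carrier → A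
      sumR-fold p f = proj₁ (sumR-unfold p f)

      sumR-fold≈Σ⟨⟩ : ∀ p f us → sumR-fold p f us ≈ Σ⟨ us ⟩ (λ u → when (p u) (f u))
      sumR-fold≈Σ⟨⟩ p f []       = refl
      sumR-fold≈Σ⟨⟩ p f (u ∷ us) with p u
      ... | true  = +-congˡ (sumR-fold≈Σ⟨⟩ p f us)
      ... | false = trans (sumR-fold≈Σ⟨⟩ p f us) (sym (+-identityˡ _))

    sumR≈Σ : ∀ p f → sumR L R p f ≈ Σ (λ u → when (p u) (f u))
    sumR≈Σ p f = sumR-fold≈Σ⟨⟩ p f elems

    fromℕ : ℕ → A
    fromℕ = ιℕ L R

    fromℤ : ℤ → A
    fromℤ = ι L R

    fromℕ-homo-+ : ∀ m n → fromℕ (m ℕ.+ n) ≈ fromℕ m + fromℕ n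
    fromℕ-homo-+ zero    n = sym (+-identityˡ _)
    fromℕ-homo-+ (suc m) n = trans (+-congˡ (fromℕ-homo-+ m n)) (sym (+-assoc _ _ _))

    fromℤ-homo-⊖ : ∀ m n → fromℤ (m ℤ.⊖ n) ≈ fromℕ m - fromℕ n
    fromℤ-homo-⊖ m zero = begin
      fromℤ (m ℤ.⊖ 0)   ≡⟨ ≡.cong fromℤ (ℤₚ.⊖-≥ {m} z≤n) ⟩
      fromℕ m           ≈⟨ +-identityʳ _ ⟨
      fromℕ m + 0#      ≈⟨ +-congˡ -0#≈0# ⟨
      fromℕ m - fromℕ 0 ∎
    fromℤ-homo-⊖ zero (suc n) = sym (+-identityˡ _)
    fromℤ-homo-⊖ (suc m) (suc n) = begin
      fromℤ (suc m ℤ.⊖ suc n)           ≡⟨ ≡.cong fromℤ (ℤₚ.[1+m]⊖[1+n]≡m⊖n m n) ⟩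
      fromℤ (m ℤ.⊖ n)                   ≈⟨ fromℤ-homo-⊖ m n ⟩
      fromℕ m - fromℕ n                 ≈⟨ +-identityˡ _ ⟨
      0# + (fromℕ m - fromℕ n)          ≈⟨ +-congʳ (-‿inverseʳ 1#) ⟨
      (1# - 1#) + (fromℕ m - fromℕ n)   ≈⟨ +-interchange 1# (- 1#) (fromℕ m) (- fromℕ n) ⟩
      (1# + fromℕ m) + (- 1# - fromℕ n) ≈⟨ +-congˡ (-‿+-comm 1# (fromℕ n)) ⟩
      fromℕ (suc m) - fromℕ (suc n)     ∎

    fromℤ-homo-+ : ∀ i j → fromℤ (i ℤ.+ j) ≈ fromℤ i + fromℤ j
    fromℤ-homo-+ -[1+ m ] -[1+ n ] = begin
      - fromℕ (suc (suc (m ℕ.+ n)))       ≡⟨ ≡.cong (-_ ∘ fromℕ) (ℕₚ.+-suc (suc m) n) ⟨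
      - fromℕ (suc m ℕ.+ suc n)           ≈⟨ -‿cong (fromℕ-homo-+ (suc m) (suc n)) ⟩
      - (fromℕ (suc m) + fromℕ (suc n))   ≈⟨ -‿+-comm _ _ ⟨
      - fromℕ (suc m) - fromℕ (suc n)     ∎
    fromℤ-homo-+ -[1+ m ] (+ n)    = trans (fromℤ-homo-⊖ n (suc m)) (+-comm _ _)
    fromℤ-homo-+ (+ m)    -[1+ n ] = fromℤ-homo-⊖ m (suc n)
    fromℤ-homo-+ (+ m)    (+ n)    = fromℕ-homo-+ m n

    fromℤ-homo-neg : ∀ i → fromℤ (ℤ.- i) ≈ - fromℤ i
    fromℤ-homo-neg -[1+ n ]    = sym (-‿involutive _)
    fromℤ-homo-neg (+ zero)    = sym -0#≈0#
    fromℤ-homo-neg (+ (suc n)) = refl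

    fromℤ-sumℤ : ∀ us p f → fromℤ (sumℤ L us p f) ≈ Σ⟨ us ⟩ (λ u → when (p u) (fromℤ (f u)))
    fromℤ-sumℤ []       p f = refl
    fromℤ-sumℤ (u ∷ us) p f with p u
    ... | true  = trans (fromℤ-homo-+ (f u) _) (+-congˡ (fromℤ-sumℤ us p f))
    ... | false = trans (fromℤ-sumℤ us p f) (sym (+-identityˡ _))

    when-support : ∀ i b y → when (not (does (i ℤ.≟ + 0)) ∧ᵇ b) (fromℤ i * y) ≈ when b (fromℤ i * y)
    when-support i b y with i ℤ.≟ + 0
    ... | yes ≡.refl = sym (when-zero b (zeroˡ y))
    ... | no _       = refl

    μᴿ : Carrier → Carrier → A
    μᴿ a b = fromℤ (μ L a b)

    μᴿ-refl : ∀ a → μᴿ a a ≈ 1#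
    μᴿ-refl a = trans (reflexive (≡.cong fromℤ (μ-refl a))) (+-identityʳ 1#)

    μᴿ-step : ∀ {a b} → a ≤ b → a ≢ b → μᴿ a b ≈ - Σ[ a , b ⟩ (μᴿ a)
    μᴿ-step {a} {b} a≤b a≢b = begin
      μᴿ a b                ≡⟨ ≡.cong fromℤ (μ-step a≤b a≢b) ⟩
      fromℤ (ℤ.- s)         ≈⟨ fromℤ-homo-neg s ⟩
      - fromℤ s             ≈⟨ -‿cong (fromℤ-sumℤ elems (_∈[ a , b ⟩) (μ L a)) ⟩
      - Σ[ a , b ⟩ (μᴿ a)   ∎
      where s = sumℤ L elems (_∈[ a , b ⟩) (μ L a)

    Σ-interval-split : ∀ {a b} → a ≤ b → ∀ f → Σ[ a , b ] f ≈ f b + Σ[ a , b ⟩ f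
    Σ-interval-split {a} {b} a≤b f = begin
      Σ[ a , b ] f                                                        ≈⟨ Σ-cong split ⟩
      Σ (λ u → when (does (u ≟ b)) (f u) + when (u ∈[ a , b ⟩) (f u))   ≈⟨ Σ-distrib-+ at-b below-b ⟩
      Σ (λ u → when (does (u ≟ b)) (f u)) + Σ[ a , b ⟩ f                 ≈⟨ +-congʳ (Σ-δ b f) ⟩
      f b + Σ[ a , b ⟩ f                                                  ∎
      where
      at-b below-b : Carrier → A
      at-b u = when (does (u ≟ b)) (f u)
      below-b u = when (u ∈[ a , b ⟩) (f u)

      split : ∀ u → when (u ∈[ a , b ]) (f u) ≈ when (does (u ≟ b)) (f u) + when (u ∈[ a , b ⟩) (f u)
      split u with u ≟ b
      ... | yes ≡.refl rewrite dec-true (a ≤? u) a≤b | dec-true (u ≤? u) ≤-refl = sym (+-identityʳ _)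
      ... | no _ rewrite Boolₚ.∧-identityʳ (does (u ≤? b)) = sym (+-identityˡ _)

    Σ-interval-empty : ∀ {a b} → ¬ a ≤ b → ∀ f → Σ[ a , b ] f ≈ 0#
    Σ-interval-empty {a} {b} a≰b f = Σ-zero empty
      where
      empty : ∀ u → when (u ∈[ a , b ]) (f u) ≈ 0#
      empty u with a ≤? u | u ≤? b
      ... | yes a≤u | yes u≤b = ⊥-elim (a≰b (≤-trans a≤u u≤b))
      ... | yes _   | no _    = refl
      ... | no _    | _       = refl

    Σ-half-open-empty : ∀ a f → Σ[ a , a ⟩ f ≈ 0#
    Σ-half-open-empty a f = Σ-zero empty
      where
      empty : ∀ u → when (u ∈[ a , a ⟩) (f u) ≈ 0#
      empty u with u ∈[ a , a ⟩ in u∈[a,a⟩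
      ... | false = refl
      ... | true with does⁻ (halfOpen? a a u) u∈[a,a⟩
      ...   | a≤u , u≤a , u≢a = ⊥-elim (u≢a (≤-antisym u≤a a≤u))

    μᴿ-interval-sum : ∀ a b → Σ[ a , b ] (μᴿ a) ≈ δ a b
    μᴿ-interval-sum a b with a ≤? b
    ... | no a≰b rewrite dec-false (a ≟ b) (λ { ≡.refl → a≰b ≤-refl }) = Σ-interval-empty a≰b (μᴿ a)
    ... | yes a≤b with a ≟ b
    ...   | yes ≡.refl = begin
      Σ[ a , a ] (μᴿ a)             ≈⟨ Σ-interval-split a≤b (μᴿ a) ⟩
      μᴿ a a + Σ[ a , a ⟩ (μᴿ a)    ≈⟨ +-cong (μᴿ-refl a) (Σ-half-open-empty a (μᴿ a)) ⟩
      1# + 0#                       ≈⟨ +-identityʳ 1# ⟩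
      1#                            ∎
    ...   | no a≢b = begin
      Σ[ a , b ] (μᴿ a)                         ≈⟨ Σ-interval-split a≤b (μᴿ a) ⟩
      μᴿ a b + Σ[ a , b ⟩ (μᴿ a)                ≈⟨ +-congʳ (μᴿ-step a≤b a≢b) ⟩
      - Σ[ a , b ⟩ (μᴿ a) + Σ[ a , b ⟩ (μᴿ a)   ≈⟨ -‿inverseˡ _ ⟩
      0#                                        ∎

    μᴿ-unique : ∀ {a} (F : Carrier → A) → (∀ v → a ≤ v → Σ[ a , v ] F ≈ δ a v) →
                ∀ v → a ≤ v → F v ≈ μᴿ a v
    μᴿ-unique {a} F F-sum v a≤v = go (suc (width a v)) v a≤v (ℕₚ.n<1+n _)
      where
      go : ∀ n v → a ≤ v → width a v ℕ.< n → F v ≈ μᴿ a v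
      go (suc n) v a≤v w<1+n = +-cancelʳ (Σ[ a , v ⟩ F) (F v) (μᴿ a v) (begin
        F v + Σ[ a , v ⟩ F            ≈⟨ Σ-interval-split a≤v F ⟨
        Σ[ a , v ] F                  ≈⟨ F-sum v a≤v ⟩
        δ a v                         ≈⟨ μᴿ-interval-sum a v ⟨
        Σ[ a , v ] (μᴿ a)             ≈⟨ Σ-interval-split a≤v (μᴿ a) ⟩
        μᴿ a v + Σ[ a , v ⟩ (μᴿ a)    ≈⟨ +-congˡ (Σ-cong below-v) ⟨
        μᴿ a v + Σ[ a , v ⟩ F         ∎)
        where
        below-v : ∀ u → when (u ∈[ a , v ⟩) (F u) ≈ when (u ∈[ a , v ⟩) (μᴿ a u)
        below-v u with u ∈[ a , v ⟩ in u∈[a,v⟩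
        ... | true  = go n u (proj₁ (does⁻ (halfOpen? a v u) u∈[a,v⟩))
                         (ℕₚ.<-≤-trans (width-< u∈[a,v⟩) (ℕₚ.≤-pred w<1+n))
        ... | false = refl

    Σ-from-⊥ : ∀ v f → Σ[ ⊥ , v ] f ≈ Σ (λ u → when (does (u ≤? v)) (f u))
    Σ-from-⊥ v f = Σ-cong λ u →
      reflexive (≡.cong (λ c → when (c ∧ᵇ does (u ≤? v)) (f u)) (dec-true (⊥ ≤? u) (minimum u)))

    complement-sum : Carrier → (Carrier → A) → A
    complement-sum x g = Σ (λ b → when (disjoint x b) (μᴿ ⊥ b * Σ[ b , b ∨ x ] (λ u → μᴿ b u * g u)))

    module LeftModularExpansion {x} (x-lm : LeftModular L x) where

      expansion-term : Carrier → Carrier → A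
      expansion-term b u = when (disjoint x b) (μᴿ ⊥ b * when (u ∈[ b , b ∨ x ]) (μᴿ b u))

      expansion : Carrier → A
      expansion u = Σ (λ b → expansion-term b u)

      private
        restrict-term : ∀ v b u → when (does (u ≤? v)) (expansion-term b u) ≈
                        when (disjoint x b) (μᴿ ⊥ b * when (u ∈[ b , v ∧ (b ∨ x) ]) (μᴿ b u))
        restrict-term v b u = begin
          when u≤v (when (disjoint x b) (μᴿ ⊥ b * when u∈[b,b∨x] (μᴿ b u)))
            ≡⟨ when-comm u≤v (disjoint x b) _ ⟩
          when (disjoint x b) (when u≤v (μᴿ ⊥ b * when u∈[b,b∨x] (μᴿ b u)))
            ≈⟨ when-cong (disjoint x b) (when-*ˡ u≤v (μᴿ ⊥ b) _) ⟩
          when (disjoint x b) (μᴿ ⊥ b * when u≤v (when u∈[b,b∨x] (μᴿ b u)))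
            ≡⟨ ≡.cong (λ c → when (disjoint x b) (μᴿ ⊥ b * c)) (when-∧ u≤v u∈[b,b∨x] (μᴿ b u)) ⟨
          when (disjoint x b) (μᴿ ⊥ b * when (u≤v ∧ᵇ u∈[b,b∨x]) (μᴿ b u))
            ≡⟨ ≡.cong (λ c → when (disjoint x b) (μᴿ ⊥ b * when c (μᴿ b u)))
                 (does-⇔ ∧-interval (u ≤? v ×-dec (b ≤? u ×-dec u ≤? (b ∨ x)))
                                    (b ≤? u ×-dec u ≤? (v ∧ (b ∨ x)))) ⟩
          when (disjoint x b) (μᴿ ⊥ b * when (u ∈[ b , v ∧ (b ∨ x) ]) (μᴿ b u))
            ∎
          where
          u≤v = does (u ≤? v)
          u∈[b,b∨x] = u ∈[ b , b ∨ x ]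

        complement-term : ∀ v b → when (disjoint x b) (μᴿ ⊥ b * δ b (v ∧ (b ∨ x))) ≈
                          when (does ((x ∧ v) ≟ ⊥)) (when (does (b ≤? v)) (μᴿ ⊥ b))
        complement-term v b = begin
          when b∧x≡⊥ (μᴿ ⊥ b * when b≡w 1#)     ≈⟨ when-cong b∧x≡⊥ (when-*ˡ b≡w (μᴿ ⊥ b) 1#) ⟨
          when b∧x≡⊥ (when b≡w (μᴿ ⊥ b * 1#))   ≈⟨ when-cong b∧x≡⊥ (when-cong b≡w (*-identityʳ _)) ⟩
          when b∧x≡⊥ (when b≡w (μᴿ ⊥ b))        ≡⟨ when-∧ b∧x≡⊥ b≡w _ ⟨
          when (b∧x≡⊥ ∧ᵇ b≡w) (μᴿ ⊥ b)          ≡⟨ ≡.cong (λ c → when c (μᴿ ⊥ b))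
                                                     (does-⇔ (left-modular-complement x-lm)
                                                       ((b ∧ x) ≟ ⊥ ×-dec b ≟ (v ∧ (b ∨ x)))
                                                       (b ≤? v ×-dec (x ∧ v) ≟ ⊥)) ⟩
          when (b≤v ∧ᵇ x∧v≡⊥) (μᴿ ⊥ b)          ≡⟨ when-∧ b≤v x∧v≡⊥ _ ⟩
          when b≤v (when x∧v≡⊥ (μᴿ ⊥ b))        ≡⟨ when-comm b≤v x∧v≡⊥ _ ⟩
          when x∧v≡⊥ (when b≤v (μᴿ ⊥ b))        ∎
          where
          b∧x≡⊥ = disjoint x b
          b≡w = does (b ≟ (v ∧ (b ∨ x)))
          b≤v = does (b ≤? v)
          x∧v≡⊥ = does ((x ∧ v) ≟ ⊥)

        when-δ⊥ : ∀ v → when (does ((x ∧ v) ≟ ⊥)) (δ ⊥ v) ≈ δ ⊥ v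
        when-δ⊥ v with ⊥ ≟ v
        ... | yes ≡.refl rewrite dec-true ((x ∧ ⊥) ≟ ⊥) (≤⊥⇒≡⊥ (x∧y≤y x ⊥)) = refl
        ... | no _ = when-zero (does ((x ∧ v) ≟ ⊥)) refl

      expansion-interval-sum : ∀ v → Σ[ ⊥ , v ] expansion ≈ δ ⊥ v
      expansion-interval-sum v = begin
        Σ[ ⊥ , v ] expansion
          ≈⟨ Σ-from-⊥ v expansion ⟩
        Σ (λ u → when (does (u ≤? v)) (Σ (λ b → expansion-term b u)))
          ≈⟨ Σ-cong (λ u → Σ-when (does (u ≤? v)) (λ b → expansion-term b u)) ⟨
        Σ (λ u → Σ (λ b → when (does (u ≤? v)) (expansion-term b u)))
          ≈⟨ Σ-comm (λ u b → when (does (u ≤? v)) (expansion-term b u)) ⟩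
        Σ (λ b → Σ (λ u → when (does (u ≤? v)) (expansion-term b u)))
          ≈⟨ Σ-cong (λ b → Σ-cong (restrict-term v b)) ⟩
        Σ (λ b → Σ (λ u → when (disjoint x b) (μᴿ ⊥ b * when (u ∈[ b , v ∧ (b ∨ x) ]) (μᴿ b u))))
          ≈⟨ Σ-cong (λ b → Σ-when-*ˡ (disjoint x b) (μᴿ ⊥ b)
                              (λ u → when (u ∈[ b , v ∧ (b ∨ x) ]) (μᴿ b u))) ⟩
        Σ (λ b → when (disjoint x b) (μᴿ ⊥ b * Σ[ b , v ∧ (b ∨ x) ] (μᴿ b)))
          ≈⟨ Σ-cong (λ b → when-cong (disjoint x b)
                              (*-congˡ {μᴿ ⊥ b} (μᴿ-interval-sum b (v ∧ (b ∨ x))))) ⟩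
        Σ (λ b → when (disjoint x b) (μᴿ ⊥ b * δ b (v ∧ (b ∨ x))))
          ≈⟨ Σ-cong (complement-term v) ⟩
        Σ (λ b → when (does ((x ∧ v) ≟ ⊥)) (when (does (b ≤? v)) (μᴿ ⊥ b)))
          ≈⟨ Σ-when (does ((x ∧ v) ≟ ⊥)) (λ b → when (does (b ≤? v)) (μᴿ ⊥ b)) ⟩
        when (does ((x ∧ v) ≟ ⊥)) (Σ (λ b → when (does (b ≤? v)) (μᴿ ⊥ b)))
          ≈⟨ when-cong _ (trans (sym (Σ-from-⊥ v (μᴿ ⊥))) (μᴿ-interval-sum ⊥ v)) ⟩
        when (does ((x ∧ v) ≟ ⊥)) (δ ⊥ v)
          ≈⟨ when-δ⊥ v ⟩
        δ ⊥ v
          ∎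

      μᴿ-left-modular : ∀ u → expansion u ≈ μᴿ ⊥ u
      μᴿ-left-modular u = μᴿ-unique expansion (λ v _ → expansion-interval-sum v) u (minimum u)

      Σ-μᴿ-left-modular : ∀ (g : Carrier → A) → Σ (λ u → μᴿ ⊥ u * g u) ≈ complement-sum x g
      Σ-μᴿ-left-modular g = begin
        Σ (λ u → μᴿ ⊥ u * g u)
          ≈⟨ Σ-cong (λ u → *-congʳ {g u} (μᴿ-left-modular u)) ⟨
        Σ (λ u → expansion u * g u)
          ≈⟨ Σ-cong (λ u → *-distribʳ-Σ (g u) (λ b → expansion-term b u)) ⟩
        Σ (λ u → Σ (λ b → expansion-term b u * g u))
          ≈⟨ Σ-comm (λ u b → expansion-term b u * g u) ⟩
        Σ (λ b → Σ (λ u → expansion-term b u * g u))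
          ≈⟨ Σ-cong (λ b → trans (Σ-cong (weigh b))
                (Σ-when-*ˡ (disjoint x b) (μᴿ ⊥ b) (λ u → when (u ∈[ b , b ∨ x ]) (μᴿ b u * g u)))) ⟩
        complement-sum x g
          ∎
        where
        weigh : ∀ b u → expansion-term b u * g u ≈
                when (disjoint x b) (μᴿ ⊥ b * when (u ∈[ b , b ∨ x ]) (μᴿ b u * g u))
        weigh b u = trans (when-*ʳ (disjoint x b) _ (g u)) (when-cong (disjoint x b)
                      (trans (*-assoc _ _ _) (*-congˡ (when-*ʳ (u ∈[ b , b ∨ x ]) (μᴿ b u) (g u)))))

    module CharacteristicPolynomial {g ℓg} (G : AbelianGroup g ℓg)
             (ρ : Carrier → Carrier → AbelianGroup.Carrier G) (ρ-rank : IsGenRank L G ρ)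
             (tpow : AbelianGroup.Carrier G → A) (tpow-hom : IsPowerMap G R tpow) where
      private
        module G = AbelianGroup G
        module T = IsPowerMap tpow-hom

      tpow-rank-shift : ∀ {u y} → u ≤ y →
                        tpow (ρ ⊥ ⊤ G.∙ ρ ⊥ y G.⁻¹) * tpow (ρ u y) ≈ tpow (ρ u ⊤)
      tpow-rank-shift {u} {y} u≤y = trans (sym (T.hom _ _)) (T.cong (G.trans
        (G.∙-congʳ (G.∙-cong (ρ-rank ⊥ u ⊤ (minimum u) (maximum u))
                             (G.⁻¹-cong (ρ-rank ⊥ u y (minimum u) u≤y))))
        (xy∙[xz]⁻¹∙z≈y G (ρ ⊥ u) (ρ u ⊤) (ρ u y))))

      χ≈Σμᴿ : χ L R ρ tpow ≈ Σ (λ u → μᴿ ⊥ u * tpow (ρ u ⊤))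
      χ≈Σμᴿ = trans (sumR≈Σ (inClosed L R ⊥ ⊤) (λ u → μᴿ ⊥ u * tpow (ρ u ⊤))) (Σ-cong λ u →
                reflexive (≡.cong (λ c → when c (μᴿ ⊥ u * tpow (ρ u ⊤)))
                  (dec-true (⊥ ≤? u ×-dec u ≤? ⊤) (minimum u , maximum u))))

      χ-int-shift : ∀ b y → tpow (ρ ⊥ ⊤ G.∙ ρ ⊥ y G.⁻¹) * χ-int L R ρ tpow b y ≈
                    Σ[ b , y ] (λ u → μᴿ b u * tpow (ρ u ⊤))
      χ-int-shift b y = begin
        t * χ-int L R ρ tpow b y
          ≈⟨ *-congˡ (sumR≈Σ (inClosed L R b y) _) ⟩
        t * Σ[ b , y ] (λ u → μᴿ b u * tpow (ρ u y))
          ≈⟨ *-distribˡ-Σ t (λ u → when (u ∈[ b , y ]) (μᴿ b u * tpow (ρ u y))) ⟩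
        Σ (λ u → t * when (u ∈[ b , y ]) (μᴿ b u * tpow (ρ u y)))
          ≈⟨ Σ-cong shift ⟩
        Σ[ b , y ] (λ u → μᴿ b u * tpow (ρ u ⊤))
          ∎
        where
        t = tpow (ρ ⊥ ⊤ G.∙ ρ ⊥ y G.⁻¹)
        shift : ∀ u → t * when (u ∈[ b , y ]) (μᴿ b u * tpow (ρ u y)) ≈
                      when (u ∈[ b , y ]) (μᴿ b u * tpow (ρ u ⊤))
        shift u with u ∈[ b , y ] in u∈[b,y]
        ... | false = zeroʳ t
        ... | true  = trans (x*yz≈y*xz t (μᴿ b u) _)
                        (*-congˡ (tpow-rank-shift (proj₂ (does⁻ (b ≤? u ×-dec u ≤? y) u∈[b,y]))))

      rhs23≈complement-sum : ∀ x → rhs23 L R G ρ tpow x ≈ complement-sum x (λ u → tpow (ρ u ⊤))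
      rhs23≈complement-sum x = trans (sumR≈Σ _ _) (Σ-cong term)
        where
        term : ∀ b → when (not (does (μ L ⊥ b ℤ.≟ + 0)) ∧ᵇ disjoint x b)
                       ((μᴿ ⊥ b * tpow (ρ ⊥ ⊤ G.∙ ρ ⊥ (b ∨ x) G.⁻¹)) * χ-int L R ρ tpow b (b ∨ x)) ≈
                     when (disjoint x b) (μᴿ ⊥ b * Σ[ b , b ∨ x ] (λ u → μᴿ b u * tpow (ρ u ⊤)))
        term b = trans (when-cong (not (does (μ L ⊥ b ℤ.≟ + 0)) ∧ᵇ disjoint x b) (*-assoc _ _ _))
                   (trans (when-support (μ L ⊥ b) (disjoint x b) _)
                     (when-cong (disjoint x b) (*-congˡ (χ-int-shift b (b ∨ x)))))

theorem2p3 : ∀ {c ℓ g ℓg r ℓr : Level}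
    (L : FiniteLattice c ℓ) (G : AbelianGroup g ℓg)
    (ρ : FiniteLattice.Carrier L → FiniteLattice.Carrier L → AbelianGroup.Carrier G)
    → IsGenRank L G ρ
    → (x : FiniteLattice.Carrier L) → LeftModular L x
    → (R : CommutativeRing r ℓr) (tpow : AbelianGroup.Carrier G → CommutativeRing.Carrier R)
    → IsPowerMap G R tpow
    → CommutativeRing._≈_ R (χ L R ρ tpow) (rhs23 L R G ρ tpow x)
theorem2p3 L G ρ ρ-rank x x-lm R tpow tpow-hom = begin
  χ L R ρ tpow                             ≈⟨ χ≈Σμᴿ ⟩
  Σ (λ u → μᴿ ⊥ u * tpow (ρ u ⊤))          ≈⟨ Σ-μᴿ-left-modular x-lm (λ u → tpow (ρ u ⊤)) ⟩
  complement-sum x (λ u → tpow (ρ u ⊤))    ≈⟨ rhs23≈complement-sum x ⟨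
  rhs23 L R G ρ tpow x                     ∎
  where
  open FiniteLattice L using (⊥; ⊤)
  open CommutativeRing R using (_*_; setoid)
  open MöbiusFunction L
  open InRing R
  open LeftModularExpansion using (Σ-μᴿ-left-modular)
  open CharacteristicPolynomial G ρ ρ-rank tpow tpow-hom
  open SetoidReasoning setoid
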